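{- When performing $n$ insertions (of arbitrary keys) into an initially empty \textsc{Lua} hybrid table, with no deletions, the insertion function is called $O(n\log n)$ times in the worst case.
   Context: \textbf{\textsc{Lua} hybrid table.} A table has an array-part, whose range of keys is $[1,2^a]$ for some $a\ge 0$ (or empty initially), and a hash-part, which is a \textsc{Lua} hashmap of size a power of two. When a key/value pair is inserted: if the key is a positive integer inside the current range of the array-part, the value is stored there. Otherwise the pair is inserted into the hash-part: placed at its hashed slot if that slot is free, otherwise into a free slot found by a downward scan with a pointer that only decreases; if no free slot exists, a rehash is triggered. At a rehash, one computes the largest $a'\ge0$ such that $[1,2^{a'}]$ contains at least $2^{a'-1}+1$ keys of the table; the new array-part has range $[1,2^{a'}]$ and receives the values of the keys in that range; all other keys are reinserted (via the insertion function) into a new hash-part of size $2^{m}$, where $m$ is chosen so that the number of elements it contains lies in $(2^{m-1},2^m]$. The number of calls to the insertion function counts one call per insertion plus the reinsertions performed during rehashes; up to a constant factor it equals $n+\sum_i\beta_i$, where $\beta_i$ is the size of the hash-part after the $i$-th rehash. -}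

module Defs where

open import Data.Nat using (ℕ; zero; suc; _+_; _*_; _^_; _≤_; _<_; _≤ᵇ_; _<ᵇ_; _%_)
open import Data.Nat.Logarithm using (⌈log₂_⌉)
open import Data.Integer using (ℤ; +_; -[1+_])
import Data.Integer as ℤ
open import Data.Sum using (_⊎_; inj₁; inj₂)
open import Data.Sum.Properties using (≡-dec)
open import Data.Bool using (Bool; true; false; if_then_else_; not; _∧_)
open import Data.Maybe using (Maybe; just; nothing; maybe)
open import Data.List using (List; []; _∷_; _++_; length; filterᵇ; map; replicate)
open import Data.Bool.ListAction using (any)
open import Data.Product using (_×_; _,_; proj₁; proj₂)
open import Relation.Binary.Definitions using (DecidableEquality)
open import Relation.Nullary.Decidable using (⌊_⌋)

-- Keys: integers (ℤ) or arbitrary other values (A, with decidable equality).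
-- hash : arbitrary hash function on keys; the slot of a key in a hash-part
-- of size s > 0 is  hash k % s.
module Lua {A : Set} (_≟A_ : DecidableEquality A) (hash : ℤ ⊎ A → ℕ) where

  Key : Set
  Key = ℤ ⊎ A

  _≟K_ : DecidableEquality Key
  _≟K_ = ≡-dec ℤ._≟_ _≟A_

  _==_ : Key → Key → Bool
  k == k' = ⌊ k ≟K k' ⌋

  posIdx : Key → Maybe ℕ
  posIdx (inj₁ (+ suc i)) = just (suc i)
  posIdx _                = nothing

  inRange : ℕ → Key → Bool
  inRange b k = maybe (λ i → i ≤ᵇ b) false (posIdx k)

  record Table : Set where
    constructor tbl
    field
      asize    : ℕ                 -- array-part range is [1, asize] (asize = 0 or 2^a)
      akeys    : List ℕ            -- indices present in the array-part
      hsize    : ℕ                 -- size of the hash-part (0 = empty/dummy, else 2^m)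
      slots    : List (Maybe Key)  -- the hash-part nodes (length hsize)
      lastfree : ℕ                 -- free-slot pointer (only decreases)
  open Table public

  emptyTable : Table
  emptyTable = tbl 0 [] 0 [] 0

  get : List (Maybe Key) → ℕ → Maybe Key
  get []       _       = nothing
  get (x ∷ xs) zero    = x
  get (x ∷ xs) (suc i) = get xs i

  isFree : List (Maybe Key) → ℕ → Bool
  isFree s i = maybe (λ _ → false) true (get s i)

  set : List (Maybe Key) → ℕ → Key → List (Maybe Key)
  set []       _       k = []
  set (x ∷ xs) zero    k = just k ∷ xs
  set (x ∷ xs) (suc i) k = x ∷ set xs i k

  scan : List (Maybe Key) → ℕ → Maybe ℕ × ℕ
  scan s zero    = nothing , zero
  scan s (suc j) = if isFree s j then (just j , j) else scan s j

  hashKeys : List (Maybe Key) → List Key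
  hashKeys []             = []
  hashKeys (nothing ∷ xs) = hashKeys xs
  hashKeys (just k ∷ xs)  = k ∷ hashKeys xs

  arrayKeys : Table → List Key
  arrayKeys t = map (λ i → inj₁ (+ i)) (akeys t)

  -- insertion of a new key into the hash-part; nothing = no free slot (rehash needed)
  hashInsert : Key → Table → Maybe Table
  hashInsert k t with hsize t
  ... | zero  = nothing
  ... | suc m with isFree (slots t) (hash k % suc m)
  ...   | true  = just record t { slots = set (slots t) (hash k % suc m) k }
  ...   | false with scan (slots t) (lastfree t)
  ...     | just j  , lf = just record t { slots = set (slots t) j k ; lastfree = lf }
  ...     | nothing , lf = nothing

  arrayStore : ℕ → Table → Table
  arrayStore i t =
    if any (λ j → ⌊ Data.Nat._≟_ j i ⌋) (akeys t) then t
    else record t { akeys = i ∷ akeys t }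

  countIn : ℕ → List Key → ℕ
  countIn b ks = length (filterᵇ (inRange b) ks)

  -- [1,2^a] contains at least 2^(a-1)+1 keys, i.e. 2^a < 2 * count
  good : List Key → ℕ → Bool
  good ks a = (2 ^ a) <ᵇ (2 * countIn (2 ^ a) ks)

  largestGood : List Key → ℕ → Maybe ℕ
  largestGood ks zero    = if good ks zero then just zero else nothing
  largestGood ks (suc a) = if good ks (suc a) then just (suc a) else largestGood ks a

  -- new array size: 2^a' for the largest good a' (which is < length ks), or 0 if none
  newASize : List Key → ℕ
  newASize ks = maybe (λ a → 2 ^ a) 0 (largestGood ks (length ks))

  hashSizeFor : ℕ → ℕ
  hashSizeFor zero    = zero
  hashSizeFor (suc c) = 2 ^ ⌈log₂ (suc c) ⌉

  -- one call of the insertion function that cannot trigger a rehash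
  -- (used for reinsertions into a freshly sized hash-part, where it never fails)
  insertNoRehash : Key → Table → Table
  insertNoRehash k t with posIdx k
  ... | just i with i ≤ᵇ asize t
  ...   | true = arrayStore i t
  ...   | false with any (k ==_) (hashKeys (slots t))
  ...     | true  = t
  ...     | false with hashInsert k t
  ...       | just t' = t'
  ...       | nothing = t
  insertNoRehash k t | nothing with any (k ==_) (hashKeys (slots t))
  ...   | true  = t
  ...   | false with hashInsert k t
  ...     | just t' = t'
  ...     | nothing = t

  reinsertAll : List Key → Table → Table
  reinsertAll []       t = t
  reinsertAll (k ∷ ks) t = reinsertAll ks (insertNoRehash k t)

  -- rehash triggered while inserting k into t; returns the new table (with k
  -- inserted by a further call) and the number of insertion calls performed:
  -- one per reinserted key plus the retried insertion of k.
  rehash : Key → Table → Table × ℕ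
  rehash k t =
    let allKs   = arrayKeys t ++ hashKeys (slots t) ++ (k ∷ [])
        as'     = newASize allKs
        hs'     = hashSizeFor (length (filterᵇ (λ x → not (inRange as' x)) allKs))
        fresh   = tbl as' (filterᵇ (λ i → i ≤ᵇ as') (akeys t)) hs' (replicate hs' nothing) hs'
        toReins = hashKeys (slots t) ++ filterᵇ (λ x → not (inRange as' x)) (arrayKeys t)
    in insertNoRehash k (reinsertAll toReins fresh) , length toReins + 1

  -- a top-level insertion: the table after it, and the number of calls of the
  -- insertion function it caused (1 + those performed in a rehash, if any)
  insert : Key → Table → Table × ℕ
  insert k t with posIdx k
  ... | just i with i ≤ᵇ asize t
  ...   | true = arrayStore i t , 1
  ...   | false = insertHash
    where
    insertHash : Table × ℕ
    insertHash with any (k ==_) (hashKeys (slots t))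
    ... | true = t , 1
    ... | false with hashInsert k t
    ...   | just t' = t' , 1
    ...   | nothing = proj₁ (rehash k t) , 1 + proj₂ (rehash k t)
  insert k t | nothing with any (k ==_) (hashKeys (slots t))
  ...   | true = t , 1
  ...   | false with hashInsert k t
  ...     | just t' = t' , 1
  ...     | nothing = proj₁ (rehash k t) , 1 + proj₂ (rehash k t)

  run : List Key → Table → Table × ℕ
  run []       t = t , 0
  run (k ∷ ks) t with insert k t
  ... | t' , c with run ks t'
  ...   | t'' , c' = t'' , c + c'

  insertCalls : List Key → ℕ
  insertCalls ks = proj₂ (run ks emptyTable)

insertCalls : {A : Set} → DecidableEquality A → (ℤ ⊎ A → ℕ) → List (ℤ ⊎ A) → ℕ
insertCalls eq h = Lua.insertCalls eq h

-- Amortized analysis with the potential Φ = 2·(keys in the hash-part) ∸ (size of the hash-part).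
-- An insertion without rehash costs 1 and raises Φ by at most 2. A rehash happens only when the
-- hash-part of size S is full, and costs S + 2 calls. If the array-part keeps its size, the new
-- hash-part holds S + 1 keys, so has size at least 2S: Φ drops from S to at most 2 and pays for the
-- rehash. Otherwise the array size, always 0 or a power of two at most 2n (more than half of its
-- range is used), strictly grows; this happens at most 2 + log₂ n times, each costing at most
-- 2n + 2. Hence n insertions make at most 5n + (2n + 2)(2 + log₂ n) calls.

module Submission where

open import Defs
open import Data.Nat using (ℕ; zero; suc; _+_; _*_; _∸_; _^_; _≤_; _<_; z≤n; s≤s; _≤ᵇ_; _%_; ⌈_/2⌉; ⌊_/2⌋; NonZero; _<?_) renaming (_≟_ to _≟ℕ_)
open import Data.Nat.Properties
open import Data.Nat.Logarithm using (⌊log₂_⌋; ⌈log₂_⌉; ⌊log₂⌋-mono-≤; ⌊log₂[2^n]⌋≡n; ⌊log₂[2*b]⌋≡1+⌊log₂b⌋)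
open import Data.Nat.Logarithm.Core using (⌈log2⌉)
open import Data.Nat.Induction using (<-wellFounded)
open import Data.Nat.Tactic.RingSolver using (solve-∀)
open import Induction.WellFounded using (Acc; acc)
open import Data.Integer using (ℤ; +_)
open import Data.Bool using (Bool; true; false; not; T)
open import Data.Bool.Properties using (T-≡)
open import Data.Bool.ListAction using (any)
open import Data.Maybe using (Maybe; just; nothing)
open import Data.List using (List; []; _∷_; _++_; length; filterᵇ; map; replicate)
open import Data.List.Properties using (length-replicate; length-map; length-++; length-removeAt′; filter-all; filter-none; filter-++)
open import Data.List.Relation.Unary.All as All using (All; []; _∷_)
open import Data.List.Relation.Unary.Any using (Any; here; there; index; _─_)
open import Data.List.Relation.Unary.Any.Properties using (any⁻)
open import Data.List.Relation.Unary.AllPairs using ([]; _∷_)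
open import Data.List.Relation.Unary.Unique.Propositional using (Unique)
import Data.List.Relation.Unary.Unique.Propositional.Properties as Unique
open import Data.List.Membership.Propositional using (_∈_; _∉_)
open import Data.List.Membership.Propositional.Properties using (∈-map⁺; ∈-map⁻; ∈-++⁻; ∈-++⁺ˡ; ∈-filter⁻)
open import Data.List.Relation.Binary.Subset.Propositional using (_⊆_)
open import Data.Product using (∃-syntax; _×_; _,_; proj₁; proj₂)
open import Data.Sum using (_⊎_; inj₁; inj₂)
open import Data.Empty using (⊥-elim)
open import Function using (_∘_)
open import Function.Bundles using (Equivalence)
open import Relation.Nullary using (¬_; yes; no)
open import Relation.Nullary.Decidable using (⌊_⌋)
open import Relation.Nullary.Decidable.Core using (T?)
open import Relation.Binary.Definitions using (DecidableEquality)
open import Relation.Binary.PropositionalEquality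

module _ {X : Set} where

  ∈-─⁺ : ∀ {x z : X} {ys} (x∈ys : x ∈ ys) → z ∈ ys → x ≢ z → z ∈ (ys ─ x∈ys)
  ∈-─⁺ (here refl) (here refl) x≢z = ⊥-elim (x≢z refl)
  ∈-─⁺ (here refl) (there z∈ys) _  = z∈ys
  ∈-─⁺ (there _)   (here refl) _   = here refl
  ∈-─⁺ (there x∈ys) (there z∈ys) x≢z = there (∈-─⁺ x∈ys z∈ys x≢z)

  Unique-⊆⇒length-≤ : ∀ {xs ys : List X} → Unique xs → xs ⊆ ys → length xs ≤ length ys
  Unique-⊆⇒length-≤ {[]}              _          _  = z≤n
  Unique-⊆⇒length-≤ {x ∷ xs} {ys} (x∉xs ∷ u) xs⊆ys = begin
      suc (length xs)          ≤⟨ s≤s (Unique-⊆⇒length-≤ u xs⊆ys─x) ⟩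
      suc (length (ys ─ x∈ys)) ≡⟨ length-removeAt′ ys (index x∈ys) ⟨
      length ys                ∎
    where
    open ≤-Reasoning
    x∈ys : x ∈ ys
    x∈ys = xs⊆ys (here refl)
    xs⊆ys─x : xs ⊆ (ys ─ x∈ys)
    xs⊆ys─x z∈xs = ∈-─⁺ x∈ys (xs⊆ys (there z∈xs)) (All.lookup x∉xs z∈xs)

  module _ (p : X → Bool) where

    filterᵇ-all : ∀ {xs} → All (λ x → p x ≡ true) xs → filterᵇ p xs ≡ xs
    filterᵇ-all = filter-all (T? ∘ p) ∘ All.map (Equivalence.from T-≡)

    filterᵇ-none : ∀ {xs} → All (λ x → p x ≡ false) xs → filterᵇ p xs ≡ []
    filterᵇ-none = filter-none (T? ∘ p) ∘ All.map (subst T)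

    ∈-filterᵇ⁻ : ∀ xs {y} → y ∈ filterᵇ p xs → y ∈ xs × p y ≡ true
    ∈-filterᵇ⁻ _ y∈ with ∈-filter⁻ (T? ∘ p) y∈
    ... | y∈xs , py = y∈xs , Equivalence.to T-≡ py

    any≡false⇒All : ∀ xs → any p xs ≡ false → All (λ x → p x ≡ false) xs
    any≡false⇒All []       _ = []
    any≡false⇒All (x ∷ xs) e with p x in px
    ... | false = px ∷ any≡false⇒All xs e

≤ᵇ≡true⇒≤ : ∀ {i b} → (i ≤ᵇ b) ≡ true → i ≤ b
≤ᵇ≡true⇒≤ {i} {b} = ≤ᵇ⇒≤ i b ∘ Equivalence.from T-≡

≤⇒≤ᵇ≡true : ∀ {i b} → i ≤ b → (i ≤ᵇ b) ≡ true
≤⇒≤ᵇ≡true = Equivalence.to T-≡ ∘ ≤⇒≤ᵇ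

≤ᵇ≡false⇒≰ : ∀ {i b} → (i ≤ᵇ b) ≡ false → ¬ i ≤ b
≤ᵇ≡false⇒≰ e i≤b = subst T e (≤⇒≤ᵇ i≤b)

ZeroOrPow2 : ℕ → Set
ZeroOrPow2 n = n ≡ 0 ⊎ ∃[ m ] n ≡ 2 ^ m

n≤2^⌈log₂n⌉ : ∀ n → n ≤ 2 ^ ⌈log₂ n ⌉
n≤2^⌈log₂n⌉ n = go n (<-wellFounded n)
  where
  n≤2*⌈n/2⌉ : ∀ n → n ≤ 2 * ⌈ n /2⌉
  n≤2*⌈n/2⌉ n = begin
    n                         ≡⟨ ⌊n/2⌋+⌈n/2⌉≡n n ⟨
    ⌊ n /2⌋ + ⌈ n /2⌉         ≤⟨ +-monoˡ-≤ ⌈ n /2⌉ (⌊n/2⌋≤⌈n/2⌉ n) ⟩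
    ⌈ n /2⌉ + ⌈ n /2⌉         ≡⟨ cong (λ x → ⌈ n /2⌉ + x) (+-identityʳ _) ⟨
    2 * ⌈ n /2⌉               ∎
    where open ≤-Reasoning
  go : ∀ n (rec : Acc _<_ n) → n ≤ 2 ^ ⌈log2⌉ n rec
  go zero          _   = z≤n
  go (suc zero)    _   = ≤-refl
  go (suc (suc n)) (acc rec) = begin
    2 + n                     ≤⟨ s≤s (s≤s (n≤2*⌈n/2⌉ n)) ⟩
    2 + 2 * ⌈ n /2⌉           ≡⟨ cong suc (+-suc ⌈ n /2⌉ (⌈ n /2⌉ + 0)) ⟨
    2 * suc ⌈ n /2⌉           ≤⟨ *-monoʳ-≤ 2 (go (suc ⌈ n /2⌉) _) ⟩
    2 * 2 ^ ⌈log2⌉ (suc ⌈ n /2⌉) _ ∎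
    where open ≤-Reasoning

n<2^n : ∀ n → n < 2 ^ n
n<2^n zero    = s≤s z≤n
n<2^n (suc n) = begin-strict
  suc n           <⟨ s≤s (n<2^n n) ⟩
  suc (2 ^ n)     ≡⟨ +-comm 1 (2 ^ n) ⟩
  2 ^ n + 1       ≤⟨ +-monoʳ-≤ (2 ^ n) (m^n>0 2 n) ⟩
  2 ^ n + 2 ^ n   ≡⟨ cong (λ x → 2 ^ n + x) (+-identityʳ _) ⟨
  2 ^ suc n       ∎
  where open ≤-Reasoning

2^<2*⇒≤ : ∀ a L → 2 ^ a < 2 * L → a ≤ L
2^<2*⇒≤ zero    L _ = z≤n
2^<2*⇒≤ (suc a) L 2^[1+a]<2L = ≤-trans (n<2^n a) (<⇒≤ (*-cancelˡ-< 2 (2 ^ a) L 2^[1+a]<2L))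

2^-cancel-< : ∀ {m p} → 2 ^ m < 2 ^ p → m < p
2^-cancel-< {m} {p} 2^m<2^p with m <? p
... | yes m<p = m<p
... | no  m≮p = ⊥-elim (<⇒≱ 2^m<2^p (^-monoʳ-≤ 2 (≮⇒≥ m≮p)))

ZeroOrPow2-<⇒2*≤ : ∀ {S S'} → ZeroOrPow2 S → ZeroOrPow2 S' → S < S' → 2 * S ≤ S'
ZeroOrPow2-<⇒2*≤ (inj₁ refl)       _                 _ = z≤n
ZeroOrPow2-<⇒2*≤ (inj₂ (m , refl)) (inj₁ refl)       ()
ZeroOrPow2-<⇒2*≤ (inj₂ (m , refl)) (inj₂ (p , refl)) 2^m<2^p = ^-monoʳ-≤ 2 {suc m} {p} (2^-cancel-< 2^m<2^p)

-- level 0 = 0 and level (2 ^ m) = 1 + m, so level counts the array sizes 0, 1, 2, 4, ... up to a.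
level : ℕ → ℕ
level a = ⌊log₂ (2 * a) ⌋

level-mono-< : ∀ {a a'} → ZeroOrPow2 a → ZeroOrPow2 a' → a < a' → level a < level a'
level-mono-< (inj₁ refl)       (inj₁ refl)       ()
level-mono-< (inj₁ refl)       (inj₂ (p , refl)) _ = subst (0 <_) (sym (⌊log₂[2^n]⌋≡n (suc p))) (s≤s z≤n)
level-mono-< (inj₂ (m , refl)) (inj₁ refl)       ()
level-mono-< (inj₂ (m , refl)) (inj₂ (p , refl)) 2^m<2^p =
  subst₂ _<_ (sym (⌊log₂[2^n]⌋≡n (suc m))) (sym (⌊log₂[2^n]⌋≡n (suc p))) (s≤s (2^-cancel-< 2^m<2^p))

level-≤ : ∀ a n .{{_ : NonZero n}} → a ≤ 2 * n → level a ≤ 2 + ⌊log₂ n ⌋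
level-≤ a n a≤2n = begin
  ⌊log₂ (2 * a) ⌋           ≤⟨ ⌊log₂⌋-mono-≤ (*-monoʳ-≤ 2 a≤2n) ⟩
  ⌊log₂ (2 * (2 * n)) ⌋     ≡⟨ ⌊log₂[2*b]⌋≡1+⌊log₂b⌋ (2 * n) {{m*n≢0 2 n}} ⟩
  1 + ⌊log₂ (2 * n) ⌋       ≡⟨ cong suc (⌊log₂[2*b]⌋≡1+⌊log₂b⌋ n) ⟩
  2 + ⌊log₂ n ⌋             ∎
  where open ≤-Reasoning

m+n∸o≤m∸o+n : ∀ m n o → m + n ∸ o ≤ (m ∸ o) + n
m+n∸o≤m∸o+n m       n zero    = ≤-refl
m+n∸o≤m∸o+n zero    n (suc o) = m∸n≤m n (suc o)
m+n∸o≤m∸o+n (suc m) n (suc o) = m+n∸o≤m∸o+n m n o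

2*m∸m≡m : ∀ m → 2 * m ∸ m ≡ m
2*m∸m≡m m = trans (cong (λ x → m + x ∸ m) (+-identityʳ m)) (m+n∸m≡n m m)

potential-step : ∀ h h' s → h' ≤ suc h → 2 * h' ∸ s ≤ (2 * h ∸ s) + 2
potential-step h h' s h'≤ = begin
  2 * h' ∸ s        ≤⟨ ∸-monoˡ-≤ s (*-monoʳ-≤ 2 h'≤) ⟩
  2 * suc h ∸ s     ≡⟨ cong (_∸ s) (*-suc 2 h) ⟩
  2 + 2 * h ∸ s     ≡⟨ cong (_∸ s) (+-comm 2 (2 * h)) ⟩
  2 * h + 2 ∸ s     ≤⟨ m+n∸o≤m∸o+n (2 * h) 2 s ⟩
  (2 * h ∸ s) + 2   ∎
  where open ≤-Reasoning

-- h keys fill a hash-part of size S; after the rehash h' ≤ h + 1 keys sit in one of size S' ≥ 2S.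
in-place-rehash-paid : ∀ h S h' S' → S ≤ h → h ≤ S → h' ≤ suc h → 2 * S ≤ S' →
                       (1 + (h + 1)) + (2 * h' ∸ S') ≤ (2 * h ∸ S) + 5
in-place-rehash-paid h S h' S' S≤h h≤S h'≤ 2S≤S' with ≤-antisym S≤h h≤S
... | refl = begin
  (1 + (h + 1)) + (2 * h' ∸ S')  ≤⟨ +-monoʳ-≤ (1 + (h + 1)) new-potential≤2 ⟩
  (1 + (h + 1)) + 2              ≡⟨ solve h ⟩
  h + 4                          ≡⟨ cong (_+ 4) (2*m∸m≡m h) ⟨
  (2 * h ∸ h) + 4                ≤⟨ +-monoʳ-≤ (2 * h ∸ h) (n≤1+n 4) ⟩
  (2 * h ∸ h) + 5                ∎
  where
  open ≤-Reasoning
  solve : ∀ h → (1 + (h + 1)) + 2 ≡ h + 4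
  solve = solve-∀
  new-potential≤2 : 2 * h' ∸ S' ≤ 2
  new-potential≤2 = begin
    2 * h' ∸ S'         ≤⟨ ∸-mono (*-monoʳ-≤ 2 h'≤) 2S≤S' ⟩
    2 * suc h ∸ 2 * h   ≡⟨ cong (_∸ 2 * h) (*-suc 2 h) ⟩
    2 + 2 * h ∸ 2 * h   ≡⟨ m+n∸n≡m 2 (2 * h) ⟩
    2                   ∎

-- A rehash that enlarges the array-part is paid by the increase of the level term.
growing-rehash-paid : ∀ h h' S' P L L' n → h ≤ n → h' ≤ n → h' ≤ S' → suc L ≤ L' →
                      (1 + (h + 1)) + (2 * h' ∸ S') + (2 * n + 2) * L ≤ P + 5 + (2 * n + 2) * L'
growing-rehash-paid h h' S' P L L' n h≤n h'≤n h'≤S' L<L' = begin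
  (1 + (h + 1)) + (2 * h' ∸ S') + B * L   ≤⟨ +-monoˡ-≤ (B * L) cost≤B ⟩
  B + B * L                               ≡⟨ *-suc B L ⟨
  B * suc L                               ≤⟨ *-monoʳ-≤ B L<L' ⟩
  B * L'                                  ≤⟨ m≤n+m (B * L') (P + 5) ⟩
  P + 5 + B * L'                          ∎
  where
  open ≤-Reasoning
  B : ℕ
  B = 2 * n + 2
  solve : ∀ n → 1 + (n + 1) + n ≡ 2 * n + 2
  solve = solve-∀
  cost≤B : (1 + (h + 1)) + (2 * h' ∸ S') ≤ B
  cost≤B = begin
    (1 + (h + 1)) + (2 * h' ∸ S') ≤⟨ +-monoˡ-≤ (2 * h' ∸ S') (s≤s (+-monoˡ-≤ 1 h≤n)) ⟩
    (1 + (n + 1)) + (2 * h' ∸ S') ≤⟨ +-monoʳ-≤ (1 + (n + 1)) (∸-monoʳ-≤ (2 * h') h'≤S') ⟩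
    (1 + (n + 1)) + (2 * h' ∸ h') ≡⟨ cong (λ x → (1 + (n + 1)) + x) (2*m∸m≡m h') ⟩
    (1 + (n + 1)) + h'            ≤⟨ +-monoʳ-≤ (1 + (n + 1)) h'≤n ⟩
    (1 + (n + 1)) + n             ≡⟨ solve n ⟩
    B                             ∎

amortized-compose : ∀ c c' p p' p'' a a' a'' s → c + p' + a ≤ p + 5 + a' → c' + p'' + a' ≤ p' + s + a'' →
                    c + c' + p'' + a ≤ p + (5 + s) + a''
amortized-compose c c' p p' p'' a a' a'' s first rest =
  +-cancelʳ-≤ (p' + a') _ _ (subst₂ _≤_ (lhs c c' p' p'' a a') (rhs p p' s a' a'') (+-mono-≤ first rest))
  where
  lhs : ∀ c c' p' p'' a a' → (c + p' + a) + (c' + p'' + a') ≡ (c + c' + p'' + a) + (p' + a')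
  lhs = solve-∀
  rhs : ∀ p p' s a' a'' → (p + 5 + a') + (p' + s + a'') ≡ (p + (5 + s) + a'') + (p' + a')
  rhs = solve-∀

5n+[2n+2][2+L]≤20nL : ∀ n L → 1 ≤ n → 1 ≤ L → 5 * n + (2 * n + 2) * (2 + L) ≤ 20 * n * L
5n+[2n+2][2+L]≤20nL (suc a) (suc b) _ _ =
  subst (5 * suc a + (2 * suc a + 2) * (2 + suc b) ≤_) (sym (solve a b)) (m≤m+n _ (18 * a * b + 9 * a + 16 * b + 3))
  where
  solve : ∀ a b → 20 * suc a * suc b ≡ (5 * suc a + (2 * suc a + 2) * (2 + suc b)) + (18 * a * b + 9 * a + 16 * b + 3)
  solve = solve-∀

module _ {A : Set} (_≟A_ : DecidableEquality A) (hash : ℤ ⊎ A → ℕ) where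
  open Lua _≟A_ hash hiding (insertCalls)

  any-==-false⇒∉ : ∀ k xs → any (k ==_) xs ≡ false → k ∉ xs
  any-==-false⇒∉ k xs e k∈xs with k ≟K k | All.lookup (any≡false⇒All (k ==_) xs e) k∈xs
  ... | yes _ | ()
  ... | no k≢k | _ = k≢k refl

  length-hashKeys-≤ : ∀ s → length (hashKeys s) ≤ length s
  length-hashKeys-≤ []            = z≤n
  length-hashKeys-≤ (nothing ∷ s) = m≤n⇒m≤1+n (length-hashKeys-≤ s)
  length-hashKeys-≤ (just _ ∷ s)  = s≤s (length-hashKeys-≤ s)

  hashKeys-replicate-nothing : ∀ n → hashKeys (replicate n nothing) ≡ []
  hashKeys-replicate-nothing zero    = refl
  hashKeys-replicate-nothing (suc n) = hashKeys-replicate-nothing n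

  length-set : ∀ s j k → length (set s j k) ≡ length s
  length-set []      _       _ = refl
  length-set (_ ∷ s) zero    _ = refl
  length-set (_ ∷ s) (suc j) k = cong suc (length-set s j k)

  ∈-hashKeys-set⁻ : ∀ s j k {z} → z ∈ hashKeys (set s j k) → z ≡ k ⊎ z ∈ hashKeys s
  ∈-hashKeys-set⁻ []            _       _ ()
  ∈-hashKeys-set⁻ (nothing ∷ s) zero    _ (here refl)  = inj₁ refl
  ∈-hashKeys-set⁻ (nothing ∷ s) zero    _ (there z∈)   = inj₂ z∈
  ∈-hashKeys-set⁻ (just _ ∷ s)  zero    _ (here refl)  = inj₁ refl
  ∈-hashKeys-set⁻ (just _ ∷ s)  zero    _ (there z∈)   = inj₂ (there z∈)
  ∈-hashKeys-set⁻ (nothing ∷ s) (suc j) k z∈           = ∈-hashKeys-set⁻ s j k z∈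
  ∈-hashKeys-set⁻ (just _ ∷ s)  (suc j) _ (here refl)  = inj₂ (here refl)
  ∈-hashKeys-set⁻ (just _ ∷ s)  (suc j) k (there z∈)   with ∈-hashKeys-set⁻ s j k z∈
  ... | inj₁ z≡k = inj₁ z≡k
  ... | inj₂ z∈s = inj₂ (there z∈s)

  length-hashKeys-set : ∀ s j k → length (hashKeys (set s j k)) ≤ suc (length (hashKeys s))
  length-hashKeys-set []            _       _ = z≤n
  length-hashKeys-set (nothing ∷ s) zero    _ = ≤-refl
  length-hashKeys-set (just _ ∷ s)  zero    _ = n≤1+n _
  length-hashKeys-set (nothing ∷ s) (suc j) k = length-hashKeys-set s j k
  length-hashKeys-set (just _ ∷ s)  (suc j) k = s≤s (length-hashKeys-set s j k)

  All-hashKeys-set : ∀ {P : Key → Set} s j k → All P (hashKeys s) → P k → All P (hashKeys (set s j k))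
  All-hashKeys-set {P} s j k Ps Pk = All.tabulate (P-∈ ∘ ∈-hashKeys-set⁻ s j k)
    where
    P-∈ : ∀ {z} → z ≡ k ⊎ z ∈ hashKeys s → P z
    P-∈ (inj₁ refl) = Pk
    P-∈ (inj₂ z∈s)  = All.lookup Ps z∈s

  Unique-hashKeys-set : ∀ s j k → Unique (hashKeys s) → k ∉ hashKeys s → Unique (hashKeys (set s j k))
  Unique-hashKeys-set []            _       _ _          _   = []
  Unique-hashKeys-set (nothing ∷ s) zero    _ u          k∉s = All.tabulate (λ z∈s k≡z → k∉s (subst (_∈ _) (sym k≡z) z∈s)) ∷ u
  Unique-hashKeys-set (just _ ∷ s)  zero    _ (_ ∷ u)    k∉s = All.tabulate (λ z∈s k≡z → k∉s (there (subst (_∈ _) (sym k≡z) z∈s))) ∷ u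
  Unique-hashKeys-set (nothing ∷ s) (suc j) k u          k∉s = Unique-hashKeys-set s j k u k∉s
  Unique-hashKeys-set (just x ∷ s)  (suc j) k (x∉s ∷ u)  k∉s =
    All.tabulate x∉ ∷ Unique-hashKeys-set s j k u (k∉s ∘ there)
    where
    x∉ : ∀ {z} → z ∈ hashKeys (set s j k) → x ≢ z
    x∉ z∈ x≡z with ∈-hashKeys-set⁻ s j k z∈
    ... | inj₁ refl = k∉s (here (sym x≡z))
    ... | inj₂ z∈s  = All.lookup x∉s z∈s x≡z

  isFree-set-occupied : ∀ s j i k → isFree s i ≡ false → isFree (set s j k) i ≡ false
  isFree-set-occupied (_ ∷ s) zero    zero    _ _ = refl
  isFree-set-occupied (_ ∷ s) zero    (suc i) _ e = e
  isFree-set-occupied (_ ∷ s) (suc j) zero    _ e = e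
  isFree-set-occupied (_ ∷ s) (suc j) (suc i) k e = isFree-set-occupied s j i k e

  isFree-set-here : ∀ s j k → j < length s → isFree (set s j k) j ≡ false
  isFree-set-here (_ ∷ s) zero    _ _         = refl
  isFree-set-here (_ ∷ s) (suc j) k (s≤s j<s) = isFree-set-here s j k j<s

  length-hashKeys-full : ∀ s → (∀ i → i < length s → isFree s i ≡ false) → length (hashKeys s) ≡ length s
  length-hashKeys-full []            _    = refl
  length-hashKeys-full (nothing ∷ s) full with full 0 (s≤s z≤n)
  ... | ()
  length-hashKeys-full (just _ ∷ s)  full = cong suc (length-hashKeys-full s (λ i i<s → full (suc i) (s≤s i<s)))

  OccupiedFrom : List (Maybe Key) → ℕ → Set
  OccupiedFrom s lf = ∀ i → lf ≤ i → i < length s → isFree s i ≡ false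

  OccupiedFrom-set : ∀ s j lf k → OccupiedFrom s lf → OccupiedFrom (set s j k) lf
  OccupiedFrom-set s j lf k occ i lf≤i i<s = isFree-set-occupied s j i k (occ i lf≤i (subst (i <_) (length-set s j k) i<s))

  scan-nothing⇒occupied : ∀ s lf {lf'} → scan s lf ≡ (nothing , lf') → ∀ i → i < lf → isFree s i ≡ false
  scan-nothing⇒occupied s (suc j) e i i<1+j with isFree s j in j-free
  scan-nothing⇒occupied s (suc j) () i i<1+j | true
  ... | false with m≤n⇒m<n∨m≡n (≤-pred i<1+j)
  ...   | inj₁ i<j  = scan-nothing⇒occupied s j e i i<j
  ...   | inj₂ refl = j-free

  scan-just : ∀ s lf {j lf'} → scan s lf ≡ (just j , lf') →
              lf' ≡ j × isFree s j ≡ true × (∀ i → j < i → i < lf → isFree s i ≡ false)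
  scan-just s (suc j₀) e with isFree s j₀ in j₀-free
  scan-just s (suc j₀) refl | true = refl , j₀-free , λ i j₀<i i<1+j₀ → ⊥-elim (<-irrefl refl (≤-trans j₀<i (≤-pred i<1+j₀)))
  ... | false with scan-just s j₀ e
  ...   | lf'≡j , j-free , occ = lf'≡j , j-free , occ′
    where
    occ′ : ∀ i → _ < i → i < suc j₀ → isFree s i ≡ false
    occ′ i j<i i<1+j₀ with m≤n⇒m<n∨m≡n (≤-pred i<1+j₀)
    ... | inj₁ i<j₀ = occ i j<i i<j₀
    ... | inj₂ refl = j₀-free

  #hash : Table → ℕ
  #hash t = length (hashKeys (slots t))

  #array : Table → ℕ
  #array t = length (akeys t)

  record WellFormed (t : Table) : Set where
    field
      length-slots     : length (slots t) ≡ hsize t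
      hsize-pow2       : ZeroOrPow2 (hsize t)
      occupied-above   : OccupiedFrom (slots t) (lastfree t)
      akeys-in-range   : All (λ i → 1 ≤ i × i ≤ asize t) (akeys t)
      hashKeys-outside : All (λ x → inRange (asize t) x ≡ false) (hashKeys (slots t))
      akeys-unique     : Unique (akeys t)
      hashKeys-unique  : Unique (hashKeys (slots t))
  open WellFormed

  emptyTable-wf : WellFormed emptyTable
  emptyTable-wf = record
    { length-slots = refl ; hsize-pow2 = inj₁ refl ; occupied-above = λ _ _ () ; akeys-in-range = []
    ; hashKeys-outside = [] ; akeys-unique = [] ; hashKeys-unique = [] }

  #hash≤hsize : ∀ t → WellFormed t → #hash t ≤ hsize t
  #hash≤hsize t wf = subst (#hash t ≤_) (length-slots wf) (length-hashKeys-≤ (slots t))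

  hashInsert-just : ∀ k t {t'} → WellFormed t → inRange (asize t) k ≡ false → k ∉ hashKeys (slots t) →
                    hashInsert k t ≡ just t' →
                    WellFormed t' × asize t' ≡ asize t × akeys t' ≡ akeys t × hsize t' ≡ hsize t × #hash t' ≤ suc (#hash t)
  hashInsert-just k (tbl as ak zero sl lf) wf out k∉ ()
  hashInsert-just k (tbl as ak (suc m) sl lf) wf out k∉ e with isFree sl (hash k % suc m)
  hashInsert-just k (tbl as ak (suc m) sl lf) wf out k∉ refl | true =
    record { length-slots = trans (length-set sl _ k) (length-slots wf)
              ; hsize-pow2 = hsize-pow2 wf ; akeys-in-range = akeys-in-range wf ; akeys-unique = akeys-unique wf
              ; occupied-above = OccupiedFrom-set sl _ lf k (occupied-above wf)
              ; hashKeys-outside = All-hashKeys-set sl _ k (hashKeys-outside wf) out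
              ; hashKeys-unique = Unique-hashKeys-set sl _ k (hashKeys-unique wf) k∉ }
    , refl , refl , refl , length-hashKeys-set sl _ k
  ... | false with scan sl lf in scanned
  hashInsert-just k (tbl as ak (suc m) sl lf) wf out k∉ () | false | nothing , _
  hashInsert-just k (tbl as ak (suc m) sl lf) wf out k∉ refl | false | just j , lf' =
    record { length-slots = trans (length-set sl _ k) (length-slots wf)
              ; hsize-pow2 = hsize-pow2 wf ; akeys-in-range = akeys-in-range wf ; akeys-unique = akeys-unique wf
              ; occupied-above = subst (OccupiedFrom (set sl j k)) (sym lf'≡j) occupied-from-j
              ; hashKeys-outside = All-hashKeys-set sl _ k (hashKeys-outside wf) out
              ; hashKeys-unique = Unique-hashKeys-set sl _ k (hashKeys-unique wf) k∉ }
    , refl , refl , refl , length-hashKeys-set sl _ k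
    where
    lf'≡j : lf' ≡ j
    lf'≡j = proj₁ (scan-just sl lf scanned)
    occupied-between : ∀ i → j < i → i < lf → isFree sl i ≡ false
    occupied-between = proj₂ (proj₂ (scan-just sl lf scanned))
    occupied-from-j : OccupiedFrom (set sl j k) j
    occupied-from-j i j≤i i<s with m≤n⇒m<n∨m≡n j≤i
    ... | inj₂ refl = isFree-set-here sl j k (subst (i <_) (length-set sl j k) i<s)
    ... | inj₁ j<i with i <? lf
    ...   | yes i<lf = isFree-set-occupied sl j i k (occupied-between i j<i i<lf)
    ...   | no  i≮lf = OccupiedFrom-set sl j lf k (occupied-above wf) i (≮⇒≥ i≮lf) i<s

  -- The scan only skips occupied slots, and the slots above lastfree are occupied.
  hashInsert-nothing⇒full : ∀ k t → WellFormed t → hashInsert k t ≡ nothing → hsize t ≤ #hash t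
  hashInsert-nothing⇒full k (tbl as ak zero sl lf) wf e = z≤n
  hashInsert-nothing⇒full k (tbl as ak (suc m) sl lf) wf e with isFree sl (hash k % suc m)
  hashInsert-nothing⇒full k (tbl as ak (suc m) sl lf) wf () | true
  ... | false with scan sl lf in scanned
  hashInsert-nothing⇒full k (tbl as ak (suc m) sl lf) wf () | false | just _ , _
  ... | nothing , _ =
    subst (_≤ length (hashKeys sl)) (length-slots wf) (≤-reflexive (sym (length-hashKeys-full sl occupied)))
    where
    occupied : ∀ i → i < length sl → isFree sl i ≡ false
    occupied i i<s with i <? lf
    ... | yes i<lf = scan-nothing⇒occupied sl lf scanned i i<lf
    ... | no  i≮lf = occupied-above wf i (≮⇒≥ i≮lf) i<s

  posIdx-just : ∀ k {i} → posIdx k ≡ just i → k ≡ inj₁ (+ i) × 1 ≤ i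
  posIdx-just (inj₁ (+ suc i)) refl = refl , s≤s z≤n

  inRange-just : ∀ b k {i} → posIdx k ≡ just i → inRange b k ≡ (i ≤ᵇ b)
  inRange-just b k e rewrite e = refl

  inRange-nothing : ∀ b k → posIdx k ≡ nothing → inRange b k ≡ false
  inRange-nothing b k e rewrite e = refl

  inRange-arrayKeys : ∀ b is → All (λ i → 1 ≤ i × i ≤ b) is → All (λ x → inRange b x ≡ true) (map (λ i → inj₁ (+ i)) is)
  inRange-arrayKeys b []          []               = []
  inRange-arrayKeys b (suc i ∷ is) ((_ , i≤b) ∷ rng) = ≤⇒≤ᵇ≡true i≤b ∷ inRange-arrayKeys b is rng

  record SmallStep (t t' : Table) : Set where
    field
      wf      : WellFormed t'
      asize-≡ : asize t' ≡ asize t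
      hsize-≡ : hsize t' ≡ hsize t
      akeys-⊆ : akeys t ⊆ akeys t'
      size-≤  : #hash t' + #array t' ≤ suc (#hash t + #array t)
  open SmallStep

  SmallStep-refl : ∀ t → WellFormed t → SmallStep t t
  SmallStep-refl t wf = record { wf = wf ; asize-≡ = refl ; hsize-≡ = refl ; akeys-⊆ = λ i∈ → i∈ ; size-≤ = n≤1+n _ }

  #hash-step : ∀ t t' → #hash t' + #array t' ≤ suc (#hash t + #array t) → #array t ≤ #array t' → #hash t' ≤ suc (#hash t)
  #hash-step t t' size≤ #array≤ = +-cancelʳ-≤ (#array t) (#hash t') (suc (#hash t)) (≤-trans (+-monoʳ-≤ (#hash t') #array≤) size≤)

  arrayStore-step : ∀ i t → WellFormed t → 1 ≤ i → i ≤ asize t → SmallStep t (arrayStore i t) × i ∈ akeys (arrayStore i t)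
  arrayStore-step i t wf 1≤i i≤a with any (λ j → ⌊ j ≟ℕ i ⌋) (akeys t) in present
  ... | true  = SmallStep-refl t wf , ∈-akeys (any⁻ _ (akeys t) (Equivalence.from T-≡ present))
    where
    ∈-akeys : ∀ {js} → Any (λ j → T ⌊ j ≟ℕ i ⌋) js → i ∈ js
    ∈-akeys {j ∷ _} (here _) with j ≟ℕ i
    ... | yes refl = here refl
    ∈-akeys (there j∈) = there (∈-akeys j∈)
  ... | false = record
      { wf = record
          { length-slots = length-slots wf ; hsize-pow2 = hsize-pow2 wf ; occupied-above = occupied-above wf
          ; akeys-in-range = (1≤i , i≤a) ∷ akeys-in-range wf ; hashKeys-outside = hashKeys-outside wf
          ; akeys-unique = All.tabulate i∉ ∷ akeys-unique wf ; hashKeys-unique = hashKeys-unique wf }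
      ; asize-≡ = refl ; hsize-≡ = refl ; akeys-⊆ = there ; size-≤ = ≤-reflexive (+-suc (#hash t) (#array t)) }
    , here refl
    where
    i∉ : ∀ {j} → j ∈ akeys t → i ≢ j
    i∉ j∈ refl with i ≟ℕ i | All.lookup (any≡false⇒All _ (akeys t) present) j∈
    ... | yes _  | ()
    ... | no i≢i | _ = i≢i refl

  hashInsert-step : ∀ k t {t'} → WellFormed t → inRange (asize t) k ≡ false → k ∉ hashKeys (slots t) →
                    hashInsert k t ≡ just t' → SmallStep t t'
  hashInsert-step k t {t'} wf out k∉ e with hashInsert-just k t wf out k∉ e
  ... | wf' , a≡ , ak≡ , h≡ , #hash≤ = record
    { wf = wf' ; asize-≡ = a≡ ; hsize-≡ = h≡ ; akeys-⊆ = subst (_ ∈_) (sym ak≡)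
    ; size-≤ = subst (λ ak → #hash t' + length ak ≤ suc (#hash t + #array t)) (sym ak≡) (+-monoˡ-≤ (#array t) #hash≤) }

  insertNoRehash-step : ∀ k t → WellFormed t →
    SmallStep t (insertNoRehash k t) × (∀ i → posIdx k ≡ just i → i ≤ asize t → i ∈ akeys (insertNoRehash k t))
  insertNoRehash-step k t wf with posIdx k in pos
  ... | just i with i ≤ᵇ asize t in i≤a
  ...   | true = let step , i∈ = arrayStore-step i t wf (proj₂ (posIdx-just k pos)) (≤ᵇ≡true⇒≤ i≤a) in step , λ { _ refl _ → i∈ }
  ...   | false with any (k ==_) (hashKeys (slots t)) in present
  ...     | true = SmallStep-refl t wf , λ { _ refl i≤a′ → ⊥-elim (≤ᵇ≡false⇒≰ i≤a i≤a′) }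
  ...     | false with hashInsert k t in inserted
  ...       | just t' = hashInsert-step k t wf (trans (inRange-just _ k pos) i≤a) (any-==-false⇒∉ k _ present) inserted
                      , λ { _ refl i≤a′ → ⊥-elim (≤ᵇ≡false⇒≰ i≤a i≤a′) }
  ...       | nothing = SmallStep-refl t wf , λ { _ refl i≤a′ → ⊥-elim (≤ᵇ≡false⇒≰ i≤a i≤a′) }
  insertNoRehash-step k t wf | nothing with any (k ==_) (hashKeys (slots t)) in present
  ...   | true = SmallStep-refl t wf , λ _ ()
  ...   | false with hashInsert k t in inserted
  ...     | just t' = hashInsert-step k t wf (inRange-nothing _ k pos) (any-==-false⇒∉ k _ present) inserted , λ _ ()
  ...     | nothing = SmallStep-refl t wf , λ _ ()

  record Reinserted (ks : List Key) (t t' : Table) : Set where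
    field
      wf             : WellFormed t'
      asize-≡        : asize t' ≡ asize t
      hsize-≡        : hsize t' ≡ hsize t
      akeys-⊆        : akeys t ⊆ akeys t'
      size-≤         : #hash t' + #array t' ≤ length ks + (#hash t + #array t)
      array-complete : ∀ {x} → x ∈ ks → ∀ {i} → posIdx x ≡ just i → i ≤ asize t → i ∈ akeys t'
  open Reinserted

  reinsertAll-reinserted : ∀ ks t → WellFormed t → Reinserted ks t (reinsertAll ks t)
  reinsertAll-reinserted []       t wf' = record
    { wf = wf' ; asize-≡ = refl ; hsize-≡ = refl ; akeys-⊆ = λ i∈ → i∈ ; size-≤ = ≤-refl ; array-complete = λ () }
  reinsertAll-reinserted (k ∷ ks) t wf' with insertNoRehash-step k t wf'
  ... | step , k-stored with reinsertAll-reinserted ks (insertNoRehash k t) (SmallStep.wf step)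
  ...   | rest = record
    { wf = wf rest
    ; asize-≡ = trans (asize-≡ rest) (SmallStep.asize-≡ step)
    ; hsize-≡ = trans (hsize-≡ rest) (SmallStep.hsize-≡ step)
    ; akeys-⊆ = akeys-⊆ rest ∘ SmallStep.akeys-⊆ step
    ; size-≤ = ≤-trans (size-≤ rest) (≤-trans (+-monoʳ-≤ (length ks) (SmallStep.size-≤ step)) (≤-reflexive (+-suc (length ks) _)))
    ; array-complete = λ { (here refl) pos i≤a → akeys-⊆ rest (k-stored _ pos i≤a)
                         ; (there x∈) pos i≤a → array-complete rest x∈ pos (subst (_ ≤_) (sym (SmallStep.asize-≡ step)) i≤a) } }

  largestGood-just⇒good : ∀ ks b {a} → largestGood ks b ≡ just a → good ks a ≡ true
  largestGood-just⇒good ks zero e with good ks zero in g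
  largestGood-just⇒good ks zero refl | true = g
  largestGood-just⇒good ks (suc b) e with good ks (suc b) in g
  largestGood-just⇒good ks (suc b) refl | true = g
  ... | false = largestGood-just⇒good ks b e

  largestGood-≥ : ∀ ks b a → good ks a ≡ true → a ≤ b → ∃[ a' ] largestGood ks b ≡ just a' × a ≤ a'
  largestGood-≥ ks zero    zero g z≤n rewrite g = zero , refl , z≤n
  largestGood-≥ ks (suc b) a    g a≤1+b with good ks (suc b) in g'
  ... | true  = suc b , refl , a≤1+b
  ... | false with m≤n⇒m<n∨m≡n a≤1+b
  ...   | inj₁ a<1+b = largestGood-≥ ks b a g (≤-pred a<1+b)
  ...   | inj₂ refl with trans (sym g) g'
  ...     | ()

  newASize-cases : ∀ ks → newASize ks ≡ 0 ⊎ ∃[ a ] newASize ks ≡ 2 ^ a × good ks a ≡ true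
  newASize-cases ks with largestGood ks (length ks) in e
  ... | nothing = inj₁ refl
  ... | just a  = inj₂ (a , refl , largestGood-just⇒good ks (length ks) e)

  newASize-≥ : ∀ ks a → good ks a ≡ true → a ≤ length ks → 2 ^ a ≤ newASize ks
  newASize-≥ ks a g a≤ with largestGood-≥ ks (length ks) a g a≤
  ... | a' , e , a≤a' rewrite e = ^-monoʳ-≤ 2 a≤a'

  hashSizeFor-pow2 : ∀ c → ZeroOrPow2 (hashSizeFor c)
  hashSizeFor-pow2 zero    = inj₁ refl
  hashSizeFor-pow2 (suc c) = inj₂ (⌈log₂ (suc c) ⌉ , refl)

  hashSizeFor-≥ : ∀ c → c ≤ hashSizeFor c
  hashSizeFor-≥ zero    = z≤n
  hashSizeFor-≥ (suc c) = n≤2^⌈log₂n⌉ (suc c)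

  -- The range [1, 2^a] holds more than 2^(a-1) keys, as when it was chosen; insertions preserve this.
  ArrayDense : Table → Set
  ArrayDense t = asize t ≡ 0 ⊎ ∃[ a ] asize t ≡ 2 ^ a × 2 ^ a < 2 * #array t

  ArrayDense⇒pow2 : ∀ t → ArrayDense t → ZeroOrPow2 (asize t)
  ArrayDense⇒pow2 t (inj₁ a≡0)          = inj₁ a≡0
  ArrayDense⇒pow2 t (inj₂ (a , a≡ , _)) = inj₂ (a , a≡)

  ArrayDense⇒asize≤ : ∀ t → ArrayDense t → asize t ≤ 2 * #array t
  ArrayDense⇒asize≤ t (inj₁ a≡0)           = subst (_≤ 2 * #array t) (sym a≡0) z≤n
  ArrayDense⇒asize≤ t (inj₂ (a , a≡ , <2K)) = subst (_≤ 2 * #array t) (sym a≡) (<⇒≤ <2K)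

  ArrayDense-step : ∀ t t' → asize t' ≡ asize t → #array t ≤ #array t' → ArrayDense t → ArrayDense t'
  ArrayDense-step t t' a≡ K≤ (inj₁ a≡0)            = inj₁ (trans a≡ a≡0)
  ArrayDense-step t t' a≡ K≤ (inj₂ (a , a≡2^ , <2K)) = inj₂ (a , trans a≡ a≡2^ , ≤-trans <2K (*-monoʳ-≤ 2 K≤))

  arrayKeys-injective : ∀ {i j : ℕ} → _≡_ {A = Key} (inj₁ (+ i)) (inj₁ (+ j)) → i ≡ j
  arrayKeys-injective refl = refl

  record RehashFacts (k : Key) (t : Table) : Set where
    field
      wf        : WellFormed (proj₁ (rehash k t))
      dense     : ArrayDense (proj₁ (rehash k t))
      cost-≡    : proj₂ (rehash k t) ≡ #hash t + 1
      size-≤    : #hash (proj₁ (rehash k t)) + #array (proj₁ (rehash k t)) ≤ suc (#hash t + #array t)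
      #array-≤  : #array t ≤ #array (proj₁ (rehash k t))
      asize-≤   : asize t ≤ asize (proj₁ (rehash k t))
      same-asize⇒hsize-grows : asize (proj₁ (rehash k t)) ≡ asize t →
                               suc (#hash t) ≤ hsize (proj₁ (rehash k t)) × 2 * hsize t ≤ hsize (proj₁ (rehash k t))
  open RehashFacts

  module Rehash (k : Key) (t : Table) (wf₀ : WellFormed t) (dense₀ : ArrayDense t)
                (out : inRange (asize t) k ≡ false) (k∉ : k ∉ hashKeys (slots t)) (failed : hashInsert k t ≡ nothing) where

    allKs : List Key
    allKs = arrayKeys t ++ hashKeys (slots t) ++ (k ∷ [])
    as' : ℕ
    as' = newASize allKs
    outside : Key → Bool
    outside x = not (inRange as' x)
    #outside : ℕ
    #outside = length (filterᵇ outside allKs)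
    hs' : ℕ
    hs' = hashSizeFor #outside
    fresh : Table
    fresh = tbl as' (filterᵇ (λ i → i ≤ᵇ as') (akeys t)) hs' (replicate hs' nothing) hs'
    toReinsert : List Key
    toReinsert = hashKeys (slots t) ++ filterᵇ outside (arrayKeys t)
    t' : Table
    t' = proj₁ (rehash k t)

    length-arrayKeys : length (arrayKeys t) ≡ #array t
    length-arrayKeys = length-map _ (akeys t)

    #array≤allKs : #array t ≤ length allKs
    #array≤allKs = begin
      #array t                  ≡⟨ length-arrayKeys ⟨
      length (arrayKeys t)      ≤⟨ m≤m+n _ _ ⟩
      length (arrayKeys t) + _  ≡⟨ length-++ (arrayKeys t) ⟨
      length allKs              ∎
      where open ≤-Reasoning

    -- The old array range is still good, so the array-part never shrinks.
    asize≤newASize : ArrayDense t → asize t ≤ as'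
    asize≤newASize (inj₁ a≡0) = subst (_≤ as') (sym a≡0) z≤n
    asize≤newASize (inj₂ (a , a≡ , <2K)) =
      subst (_≤ as') (sym a≡) (newASize-≥ allKs a a-good (2^<2*⇒≤ a _ (≤-trans <2K (*-monoʳ-≤ 2 #array≤allKs))))
      where
      array-in-range : All (λ x → inRange (2 ^ a) x ≡ true) (arrayKeys t)
      array-in-range = inRange-arrayKeys (2 ^ a) (akeys t)
                         (subst (λ b → All (λ i → 1 ≤ i × i ≤ b) (akeys t)) a≡ (akeys-in-range wf₀))
      in-a : Key → Bool
      in-a = inRange (2 ^ a)
      #array≤count : #array t ≤ countIn (2 ^ a) allKs
      #array≤count = begin
        #array t                          ≡⟨ trans (cong length (filterᵇ-all (inRange (2 ^ a)) array-in-range)) length-arrayKeys ⟨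
        length (filterᵇ in-a (arrayKeys t))   ≤⟨ m≤m+n _ _ ⟩
        length (filterᵇ in-a (arrayKeys t)) + _
          ≡⟨ trans (cong length (filter-++ (T? ∘ in-a) (arrayKeys t) _)) (length-++ (filterᵇ in-a (arrayKeys t))) ⟨
        countIn (2 ^ a) allKs             ∎
        where open ≤-Reasoning
      a-good : good allKs a ≡ true
      a-good = Equivalence.to T-≡ (<⇒<ᵇ (≤-trans <2K (*-monoʳ-≤ 2 #array≤count)))

    asize≤as' : asize t ≤ as'
    asize≤as' = asize≤newASize dense₀

    akeys-in-range' : All (λ i → 1 ≤ i × i ≤ as') (akeys t)
    akeys-in-range' = All.map (λ (1≤i , i≤a) → 1≤i , ≤-trans i≤a asize≤as') (akeys-in-range wf₀)

    akeys-kept : filterᵇ (λ i → i ≤ᵇ as') (akeys t) ≡ akeys t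
    akeys-kept = filterᵇ-all _ (All.map (≤⇒≤ᵇ≡true ∘ proj₂) akeys-in-range')

    array-not-reinserted : filterᵇ outside (arrayKeys t) ≡ []
    array-not-reinserted = filterᵇ-none outside (All.map (cong not) (inRange-arrayKeys as' (akeys t) akeys-in-range'))

    fresh-wf : WellFormed fresh
    fresh-wf = record
      { length-slots = length-replicate hs'
      ; hsize-pow2 = hashSizeFor-pow2 #outside
      ; occupied-above = λ i hs'≤i i<hs' → ⊥-elim (<-irrefl refl (≤-trans i<hs' (≤-trans (≤-reflexive (length-replicate hs')) hs'≤i)))
      ; akeys-in-range = subst (All (λ i → 1 ≤ i × i ≤ as')) (sym akeys-kept) akeys-in-range'
      ; hashKeys-outside = subst (All (λ x → inRange as' x ≡ false)) (sym (hashKeys-replicate-nothing hs')) []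
      ; akeys-unique = subst Unique (sym akeys-kept) (akeys-unique wf₀)
      ; hashKeys-unique = subst Unique (sym (hashKeys-replicate-nothing hs')) [] }

    t₁ : Table
    t₁ = reinsertAll toReinsert fresh
    phase₁ : Reinserted toReinsert fresh t₁
    phase₁ = reinsertAll-reinserted toReinsert fresh fresh-wf
    phase₂ : SmallStep t₁ t' × (∀ i → posIdx k ≡ just i → i ≤ asize t₁ → i ∈ akeys t')
    phase₂ = insertNoRehash-step k t₁ (wf phase₁)
    final : SmallStep t₁ t'
    final = proj₁ phase₂

    asize' : asize t' ≡ as'
    asize' = trans (SmallStep.asize-≡ final) (asize-≡ phase₁)

    hsize' : hsize t' ≡ hs'
    hsize' = trans (SmallStep.hsize-≡ final) (hsize-≡ phase₁)

    akeys⊆ : akeys t ⊆ akeys t'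
    akeys⊆ {i} i∈ = SmallStep.akeys-⊆ final (akeys-⊆ phase₁ (subst (i ∈_) (sym akeys-kept) i∈))

    length-toReinsert : length toReinsert ≡ #hash t
    length-toReinsert = begin
      length (hashKeys (slots t) ++ filterᵇ outside (arrayKeys t))
        ≡⟨ cong (λ ks → length (hashKeys (slots t) ++ ks)) array-not-reinserted ⟩
      length (hashKeys (slots t) ++ [])  ≡⟨ length-++ (hashKeys (slots t)) ⟩
      #hash t + 0                        ≡⟨ +-identityʳ _ ⟩
      #hash t                            ∎
      where open ≡-Reasoning

    size≤ : #hash t' + #array t' ≤ suc (#hash t + #array t)
    size≤ = begin
      #hash t' + #array t'                                   ≤⟨ SmallStep.size-≤ final ⟩
      suc (#hash t₁ + #array t₁)                             ≤⟨ s≤s (size-≤ phase₁) ⟩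
      suc (length toReinsert + (#hash fresh + #array fresh))
        ≡⟨ cong suc (cong₂ _+_ length-toReinsert
             (cong₂ _+_ (cong length (hashKeys-replicate-nothing hs')) (cong length akeys-kept))) ⟩
      suc (#hash t + #array t)                               ∎
      where open ≤-Reasoning

    allKs-unique : Unique allKs
    allKs-unique = Unique.++⁺ (Unique.map⁺ arrayKeys-injective (akeys-unique wf₀))
                              (Unique.++⁺ (hashKeys-unique wf₀) ([] ∷ []) hash-disjoint-k) array-disjoint
      where
      hash-disjoint-k : ∀ {x} → ¬ (x ∈ hashKeys (slots t) × x ∈ (k ∷ []))
      hash-disjoint-k (x∈ , here refl) = k∉ x∈
      outside-old : ∀ {x} → x ∈ hashKeys (slots t) ⊎ x ∈ (k ∷ []) → inRange (asize t) x ≡ false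
      outside-old (inj₁ x∈)        = All.lookup (hashKeys-outside wf₀) x∈
      outside-old (inj₂ (here refl)) = out
      array-disjoint : ∀ {x} → ¬ (x ∈ arrayKeys t × x ∈ hashKeys (slots t) ++ (k ∷ []))
      array-disjoint (x∈a , x∈h) with trans (sym (All.lookup (inRange-arrayKeys (asize t) (akeys t) (akeys-in-range wf₀)) x∈a))
                                            (outside-old (∈-++⁻ (hashKeys (slots t)) x∈h))
      ... | ()

    index-stored : ∀ {x} → x ∈ allKs → ∀ {i} → posIdx x ≡ just i → i ≤ as' → i ∈ akeys t'
    index-stored x∈ {i} pos i≤ with ∈-++⁻ (arrayKeys t) x∈
    ... | inj₁ x∈a with ∈-map⁻ (λ i → inj₁ (+ i)) x∈a
    ...   | j , j∈ , x≡j with arrayKeys-injective (trans (sym (proj₁ (posIdx-just _ pos))) x≡j)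
    ...     | refl = akeys⊆ j∈
    index-stored x∈ {i} pos i≤ | inj₂ x∈hk with ∈-++⁻ (hashKeys (slots t)) x∈hk
    ... | inj₁ x∈h = SmallStep.akeys-⊆ final (array-complete phase₁ (∈-++⁺ˡ x∈h) pos i≤)
    ... | inj₂ (here refl) = proj₂ phase₂ i pos (subst (i ≤_) (sym (asize-≡ phase₁)) i≤)

    inRange⊆arrayKeys : filterᵇ (inRange as') allKs ⊆ arrayKeys t'
    inRange⊆arrayKeys {x} x∈ = stored (posIdx x) refl
      where
      x∈allKs : x ∈ allKs
      x∈allKs = proj₁ (∈-filterᵇ⁻ (inRange as') allKs x∈)
      x-in : inRange as' x ≡ true
      x-in = proj₂ (∈-filterᵇ⁻ (inRange as') allKs x∈)
      stored : ∀ p → posIdx x ≡ p → x ∈ arrayKeys t'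
      stored nothing pos with trans (sym (inRange-nothing as' x pos)) x-in
      ... | ()
      stored (just i) pos with posIdx-just x pos
      ... | refl , _ = ∈-map⁺ (λ i → inj₁ (+ i)) (index-stored x∈allKs pos (≤ᵇ≡true⇒≤ (trans (sym (inRange-just as' x pos)) x-in)))

    dense' : ArrayDense t'
    dense' with newASize-cases allKs
    ... | inj₁ as'≡0 = inj₁ (trans asize' as'≡0)
    ... | inj₂ (a , as'≡ , a-good) = inj₂ (a , trans asize' as'≡ , ≤-trans 2^a<2count (*-monoʳ-≤ 2 count≤))
      where
      2^a<2count : 2 ^ a < 2 * countIn (2 ^ a) allKs
      2^a<2count = <ᵇ⇒< _ _ (Equivalence.from T-≡ a-good)
      count≤ : countIn (2 ^ a) allKs ≤ #array t'
      count≤ = subst (λ b → countIn b allKs ≤ #array t') as'≡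
                 (subst (countIn as' allKs ≤_) (length-map _ (akeys t'))
                   (Unique-⊆⇒length-≤ (Unique.filter⁺ (T? ∘ inRange as') allKs-unique) inRange⊆arrayKeys))

    same-asize⇒hsize-grows′ : asize t' ≡ asize t → suc (#hash t) ≤ hsize t' × 2 * hsize t ≤ hsize t'
    same-asize⇒hsize-grows′ same =
      #hash<hsize' ,
      ZeroOrPow2-<⇒2*≤ (hsize-pow2 wf₀) (subst ZeroOrPow2 (sym hsize') (hashSizeFor-pow2 #outside))
        (≤-trans (s≤s (hashInsert-nothing⇒full k t wf₀ failed)) #hash<hsize')
      where
      as'≡ : as' ≡ asize t
      as'≡ = trans (sym asize') same
      newKeys = hashKeys (slots t) ++ (k ∷ [])
      outside-new : ∀ {x} → x ∈ hashKeys (slots t) ⊎ x ∈ (k ∷ []) → inRange as' x ≡ false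
      outside-new {x} (inj₁ x∈)         = subst (λ b → inRange b x ≡ false) (sym as'≡) (All.lookup (hashKeys-outside wf₀) x∈)
      outside-new     (inj₂ (here refl)) = subst (λ b → inRange b k ≡ false) (sym as'≡) out
      newKeys-outside : filterᵇ outside newKeys ≡ newKeys
      newKeys-outside = filterᵇ-all outside (All.tabulate (cong not ∘ outside-new ∘ ∈-++⁻ (hashKeys (slots t))))
      #hash<#outside : suc (#hash t) ≤ #outside
      #hash<#outside = begin
        suc (#hash t)                                      ≡⟨ +-comm 1 (#hash t) ⟩
        #hash t + 1                                        ≡⟨ length-++ (hashKeys (slots t)) ⟨
        length newKeys                                     ≡⟨ cong length newKeys-outside ⟨
        length (filterᵇ outside newKeys)                   ≤⟨ m≤n+m _ _ ⟩
        length (filterᵇ outside (arrayKeys t)) + length (filterᵇ outside newKeys)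
                                                           ≡⟨ trans (cong length (filter-++ (T? ∘ outside) (arrayKeys t) newKeys))
                                                                    (length-++ (filterᵇ outside (arrayKeys t))) ⟨
        #outside                                           ∎
        where open ≤-Reasoning
      #hash<hsize' : suc (#hash t) ≤ hsize t'
      #hash<hsize' = subst (suc (#hash t) ≤_) (sym hsize') (≤-trans #hash<#outside (hashSizeFor-≥ #outside))

    facts : RehashFacts k t
    facts = record
      { wf = SmallStep.wf final ; dense = dense' ; cost-≡ = cong (_+ 1) length-toReinsert ; size-≤ = size≤
      ; #array-≤ = Unique-⊆⇒length-≤ (akeys-unique wf₀) akeys⊆ ; asize-≤ = subst (asize t ≤_) (sym asize') asize≤as'
      ; same-asize⇒hsize-grows = same-asize⇒hsize-grows′ }

  Φ : Table → ℕ
  Φ t = 2 * #hash t ∸ hsize t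

  arrayLevel : Table → ℕ
  arrayLevel t = level (asize t)

  record Invariant (m : ℕ) (t : Table) : Set where
    field
      wf     : WellFormed t
      dense  : ArrayDense t
      size-≤ : #hash t + #array t ≤ m
  open Invariant

  record Amortized (B m : ℕ) (t t' : Table) (c : ℕ) : Set where
    field
      invariant : Invariant (suc m) t'
      cost-≤    : c + Φ t' + B * arrayLevel t ≤ Φ t + 5 + B * arrayLevel t'
  open Amortized

  SmallStep-amortized : ∀ B m t t' → Invariant m t → SmallStep t t' → Amortized B m t t' 1
  SmallStep-amortized B m t t' inv step = record
    { invariant = record
        { wf = SmallStep.wf step ; dense = ArrayDense-step t t' (SmallStep.asize-≡ step) #array≤ (dense inv)
        ; size-≤ = ≤-trans (SmallStep.size-≤ step) (s≤s (size-≤ inv)) }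
    ; cost-≤ = subst (λ a → 1 + Φ t' + B * level a ≤ Φ t + 5 + B * arrayLevel t') (SmallStep.asize-≡ step)
                 (+-monoˡ-≤ (B * arrayLevel t') cost) }
    where
    #array≤ : #array t ≤ #array t'
    #array≤ = Unique-⊆⇒length-≤ (akeys-unique (wf inv)) (SmallStep.akeys-⊆ step)
    Φ' : Φ t' ≤ Φ t + 2
    Φ' = subst (λ s → 2 * #hash t' ∸ s ≤ Φ t + 2) (sym (SmallStep.hsize-≡ step))
           (potential-step (#hash t) (#hash t') (hsize t) (#hash-step t t' (SmallStep.size-≤ step) #array≤))
    cost : 1 + Φ t' ≤ Φ t + 5
    cost = begin
      1 + Φ t'        ≤⟨ s≤s Φ' ⟩
      1 + (Φ t + 2)   ≡⟨ +-suc (Φ t) 2 ⟨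
      Φ t + 3         ≤⟨ +-monoʳ-≤ (Φ t) (s≤s (s≤s (s≤s z≤n))) ⟩
      Φ t + 5         ∎
      where open ≤-Reasoning

  rehash-amortized : ∀ n m k t → Invariant m t → m < n →
                     inRange (asize t) k ≡ false → k ∉ hashKeys (slots t) → hashInsert k t ≡ nothing →
                     Amortized (2 * n + 2) m t (proj₁ (rehash k t)) (1 + proj₂ (rehash k t))
  rehash-amortized n m k t inv m<n out k∉ failed = record
    { invariant = record { wf = wf R ; dense = dense R ; size-≤ = ≤-trans (size-≤ R) (s≤s (size-≤ inv)) }
    ; cost-≤ = subst (λ c → 1 + c + Φ t' + B * arrayLevel t ≤ Φ t + 5 + B * arrayLevel t') (sym (cost-≡ R)) paid }
    where
    R : RehashFacts k t
    R = Rehash.facts k t (wf inv) (dense inv) out k∉ failed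
    t' : Table
    t' = proj₁ (rehash k t)
    B : ℕ
    B = 2 * n + 2
    paid : 1 + (#hash t + 1) + Φ t' + B * arrayLevel t ≤ Φ t + 5 + B * arrayLevel t'
    paid with m≤n⇒m<n∨m≡n (asize-≤ R)
    ... | inj₂ same = subst (λ a → 1 + (#hash t + 1) + Φ t' + B * arrayLevel t ≤ Φ t + 5 + B * level a) same
            (+-monoˡ-≤ (B * arrayLevel t)
              (in-place-rehash-paid (#hash t) (hsize t) (#hash t') (hsize t')
                 (hashInsert-nothing⇒full k t (wf inv) failed) (#hash≤hsize t (wf inv))
                 (#hash-step t t' (size-≤ R) (#array-≤ R)) (proj₂ (same-asize⇒hsize-grows R (sym same)))))
    ... | inj₁ grows = growing-rehash-paid (#hash t) (#hash t') (hsize t') (Φ t) (arrayLevel t) (arrayLevel t') n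
            (≤-trans (m≤m+n (#hash t) (#array t)) (≤-trans (size-≤ inv) (<⇒≤ m<n)))
            (≤-trans (m≤m+n (#hash t') (#array t')) (≤-trans (size-≤ R) (≤-trans (s≤s (size-≤ inv)) m<n)))
            (#hash≤hsize t' (wf R))
            (level-mono-< (ArrayDense⇒pow2 t (dense inv)) (ArrayDense⇒pow2 t' (dense R)) grows)

  insert-amortized : ∀ n m k t → Invariant m t → m < n → Amortized (2 * n + 2) m t (proj₁ (insert k t)) (proj₂ (insert k t))
  insert-amortized n m k t inv m<n with posIdx k in pos
  ... | just i with i ≤ᵇ asize t in i≤a
  ...   | true = SmallStep-amortized _ m t _ inv (proj₁ (arrayStore-step i t (wf inv) (proj₂ (posIdx-just k pos)) (≤ᵇ≡true⇒≤ i≤a)))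
  ...   | false with any (k ==_) (hashKeys (slots t)) in present
  ...     | true = SmallStep-amortized _ m t t inv (SmallStep-refl t (wf inv))
  ...     | false with hashInsert k t in inserted
  ...       | just t' = SmallStep-amortized _ m t t' inv
                          (hashInsert-step k t (wf inv) (trans (inRange-just _ k pos) i≤a) (any-==-false⇒∉ k _ present) inserted)
  ...       | nothing = rehash-amortized n m k t inv m<n (trans (inRange-just _ k pos) i≤a) (any-==-false⇒∉ k _ present) inserted
  insert-amortized n m k t inv m<n | nothing with any (k ==_) (hashKeys (slots t)) in present
  ...   | true = SmallStep-amortized _ m t t inv (SmallStep-refl t (wf inv))
  ...   | false with hashInsert k t in inserted
  ...     | just t' = SmallStep-amortized _ m t t' inv
                        (hashInsert-step k t (wf inv) (inRange-nothing _ k pos) (any-==-false⇒∉ k _ present) inserted)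
  ...     | nothing = rehash-amortized n m k t inv m<n (inRange-nothing _ k pos) (any-==-false⇒∉ k _ present) inserted

  run-amortized : ∀ n ks t m → Invariant m t → m + length ks ≤ n →
    Invariant (m + length ks) (proj₁ (run ks t)) ×
    proj₂ (run ks t) + Φ (proj₁ (run ks t)) + (2 * n + 2) * arrayLevel t
      ≤ Φ t + 5 * length ks + (2 * n + 2) * arrayLevel (proj₁ (run ks t))
  run-amortized n [] t m inv _ =
    subst (λ m → Invariant m t) (sym (+-identityʳ m)) inv , ≤-reflexive (cong (_+ (2 * n + 2) * arrayLevel t) (sym (+-identityʳ (Φ t))))
  run-amortized n (k ∷ ks) t m inv m+[1+ks]≤n with insert k t | insert-amortized n m k t inv m<n
    where
    m<n : m < n
    m<n = ≤-trans (s≤s (m≤m+n m (length ks))) (≤-trans (≤-reflexive (sym (+-suc m (length ks)))) m+[1+ks]≤n)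
  ... | t' , c | first with run ks t'
                          | run-amortized n ks t' (suc m) (invariant first) (≤-trans (≤-reflexive (sym (+-suc m (length ks)))) m+[1+ks]≤n)
  ...   | t'' , c' | inv'' , rest =
    subst (λ m' → Invariant m' t'') (sym (+-suc m (length ks))) inv'' ,
    subst (λ s → c + c' + Φ t'' + (2 * n + 2) * arrayLevel t ≤ Φ t + s + (2 * n + 2) * arrayLevel t'') (sym (*-suc 5 (length ks)))
      (amortized-compose c c' (Φ t) (Φ t') (Φ t'') _ _ _ _ (cost-≤ first) rest)

  emptyTable-invariant : Invariant 0 emptyTable
  emptyTable-invariant = record { wf = emptyTable-wf ; dense = inj₁ refl ; size-≤ = z≤n }

  insertCalls-≤ : ∀ ks → insertCalls _≟A_ hash ks ≤ 5 * length ks + (2 * length ks + 2) * (2 + ⌊log₂ length ks ⌋)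
  insertCalls-≤ []          = z≤n
  insertCalls-≤ ks@(_ ∷ _) = begin
    proj₂ (run ks emptyTable)                              ≤⟨ m≤m+n _ _ ⟩
    proj₂ (run ks emptyTable) + Φ t                        ≤⟨ m≤m+n _ _ ⟩
    proj₂ (run ks emptyTable) + Φ t + B * arrayLevel emptyTable ≤⟨ proj₂ amortized ⟩
    5 * n + B * arrayLevel t                               ≤⟨ +-monoʳ-≤ (5 * n) (*-monoʳ-≤ B (level-≤ (asize t) n asize≤2n)) ⟩
    5 * n + B * (2 + ⌊log₂ n ⌋)                            ∎
    where
    open ≤-Reasoning
    n : ℕ
    n = length ks
    B : ℕ
    B = 2 * n + 2
    t : Table
    t = proj₁ (run ks emptyTable)
    amortized : Invariant n t × proj₂ (run ks emptyTable) + Φ t + B * arrayLevel emptyTable ≤ Φ emptyTable + 5 * n + B * arrayLevel t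
    amortized = run-amortized n ks emptyTable 0 emptyTable-invariant ≤-refl
    asize≤2n : asize t ≤ 2 * n
    asize≤2n = ≤-trans (ArrayDense⇒asize≤ t (dense (proj₁ amortized)))
                 (*-monoʳ-≤ 2 (≤-trans (m≤n+m (#array t) (#hash t)) (size-≤ (proj₁ amortized))))

proposition2 : ∃[ c ] ∃[ N ] ((A : Set) (eq : DecidableEquality A) (hash : ℤ ⊎ A → ℕ)
                 (keys : List (ℤ ⊎ A)) → N ≤ length keys →
                 insertCalls eq hash keys ≤ c * length keys * ⌊log₂ length keys ⌋)
proposition2 = 20 , 2 , λ A eq hash keys 2≤n →
  ≤-trans (insertCalls-≤ eq hash keys)
          (5n+[2n+2][2+L]≤20nL (length keys) _ (≤-trans (s≤s z≤n) 2≤n) (⌊log₂⌋-mono-≤ 2≤n))
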